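{- Let $W$ be a finite real reflection group acting on $\mathbb{R}^n$ with simple system spanning $\mathbb{R}^n$ and simple reflections $S$, and let $W'$ be the group generated by $S$ subject only to $s^2=1$ ($s\in S$) and $st=ts$ whenever $m(s,t)=2$, where $m(s,t)$ is the order of $st$ in $W$. Let $w,v$ be words in $S$. (1) If $w=1$ in $W'$, then the loop $g(w)$ is $(n-2)$-homotopic to the trivial loop $(\sigma_0)$ in $\mathscr{C}(W)$. (2) If $w$ represents the identity of $W$ and $w=v$ in $W'$, then $g(w)\simeq_{n-2}g(v)$.
   Context: Coxeter complex $\mathscr{C}(W)$: the simplicial complex with vertices the cosets $wW_{S\setminus\{s\}}$ ($W_I=\langle I\rangle$) and faces the sets $\{wW_{S\setminus\{s\}}: s\in J\}$ for $w\in W$, $J\subseteq S$; its maximal simplices are identified with elements of $W$, and $\sigma_0$ denotes the one corresponding to the identity; maximal simplices $u$ and $us$ ($s\in S$) share $n-1$ vertices. For a word $w=s_1\cdots s_m$ in $S$, $g(w)$ is the chain of maximal simplices $(\sigma_0,\ s_1,\ s_1s_2,\ \dots,\ s_1s_2\cdots s_m)$ (products in $W$); when $w$ represents the identity of $W$ this is an $(n-2)$-loop based at $\sigma_0$. Discrete homotopy: simplices are $q$-near if they share at least $q+1$ vertices; a $q$-loop based at $\sigma_0$ is a sequence of simplices starting and ending at $\sigma_0$ with consecutive terms $q$-near; $\simeq_q$ is the equivalence relation generated by stretching (repeating an entry) and homotopy grids (a finite sequence of $q$-loops based at $\sigma_0$ of equal length from one loop to the other, with entries in the same position of consecutive loops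 $q$-near). -}

module Defs where

open import Level using (Level; _⊔_)
open import Algebra.Bundles using (Group)
open import Algebra.Morphism.Structures using (IsGroupHomomorphism)
open import Data.Nat using (ℕ; zero; suc; _≤_; _<_)
open import Data.Fin using (Fin)
open import Data.List using (List; []; _∷_; _++_; length)
open import Data.List.Relation.Unary.All using (All)
open import Data.List.Relation.Unary.AllPairs using (AllPairs)
open import Data.List.Relation.Binary.Pointwise using (Pointwise)
open import Data.Product using (Σ; Σ-syntax; _×_; ∃)
open import Relation.Nullary using (¬_)
open import Relation.Binary.PropositionalEquality using (_≡_; _≢_)
open import Relation.Binary.Construct.Closure.Equivalence using (EqClosure)

pow : {c ℓ : Level} (G : Group c ℓ) → Group.Carrier G → ℕ → Group.Carrier G
pow G g zero    = Group.ε G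
pow G g (suc k) = Group._∙_ G g (pow G g k)

module _ {c ℓ : Level} (W : Group c ℓ) where
  open Group W

  IsOrder : Carrier → ℕ → Set ℓ
  IsOrder g m = (0 < m) × (pow W g m ≈ ε) × (∀ k → 0 < k → k < m → ¬ (pow W g k ≈ ε))

  IsFinite : Set (c ⊔ ℓ)
  IsFinite = Σ[ k ∈ ℕ ] Σ[ f ∈ (Fin k → Carrier) ] (∀ x → Σ[ i ∈ Fin k ] x ≈ f i)

  module _ {n : ℕ} (gen : Fin n → Carrier) where

    eval : List (Fin n) → Carrier
    eval []      = ε
    eval (s ∷ w) = gen s ∙ eval w

    m[_,_]≡_ : Fin n → Fin n → ℕ → Set ℓ
    m[ s , t ]≡ m = IsOrder (gen s ∙ gen t) m

    -- (W, S) is a Coxeter system of rank n, S = {gen s}: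
    -- S consists of n distinct involutions generating W, and W has the
    -- presentation ⟨ S ∣ (st)^{m(s,t)} = 1 ⟩ (universal property).
    record IsCoxeterSystem : Set (Level.suc (c ⊔ ℓ)) where
      field
        involution  : ∀ s → gen s ∙ gen s ≈ ε
        nontrivial  : ∀ s → ¬ (gen s ≈ ε)
        injective   : ∀ s t → gen s ≈ gen t → s ≡ t
        generates   : ∀ x → Σ[ w ∈ List (Fin n) ] x ≈ eval w
        universal   : (H : Group c ℓ) (h : Fin n → Group.Carrier H) →
                      (∀ s t m → m[ s , t ]≡ m →
                         Group._≈_ H (pow H (Group._∙_ H (h s) (h t)) m) (Group.ε H)) →
                      Σ[ φ ∈ (Carrier → Group.Carrier H) ]
                        IsGroupHomomorphism (Group.rawGroup W) (Group.rawGroup H) φ ×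
                        (∀ s → Group._≈_ H (φ (gen s)) (h s))

    -- The group W' = ⟨ S ∣ s² = 1, st = ts if m(s,t) = 2 ⟩ :
    -- equality of words in W' is the congruence generated by these relations.

    data W'Step : List (Fin n) → List (Fin n) → Set ℓ where
      cancel : ∀ xs ys s → W'Step (xs ++ s ∷ s ∷ ys) (xs ++ ys)
      commute : ∀ xs ys s t → m[ s , t ]≡ 2 →
                W'Step (xs ++ s ∷ t ∷ ys) (xs ++ t ∷ s ∷ ys)

    _≡W'_ : List (Fin n) → List (Fin n) → Set ℓ
    _≡W'_ = EqClosure W'Step

    InParabolic : Fin n → Carrier → Set ℓ
    InParabolic s x = Σ[ w ∈ List (Fin n) ] All (λ t → t ≢ s) w × (x ≈ eval w)

    -- a vertex u W_{S∖{s}} is represented by the pair (s , u)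
    Vertex : Set c
    Vertex = Fin n × Carrier

    InVertex : Vertex → Carrier → Set (c ⊔ ℓ)
    InVertex (s Data.Product., u) x = Σ[ y ∈ Carrier ] InParabolic s y × (x ≈ u ∙ y)

    SameVertex : Vertex → Vertex → Set (c ⊔ ℓ)
    SameVertex a b = ∀ x → (InVertex a x → InVertex b x) × (InVertex b x → InVertex a x)

    VertexOf : Carrier → Vertex → Set (c ⊔ ℓ)
    VertexOf u a = Σ[ s ∈ Fin n ] SameVertex a (s Data.Product., u)

    -- maximal simplices u, v share at least k vertices
    -- (q-near is  Near (q+1))
    Near : ℕ → Carrier → Carrier → Set (c ⊔ ℓ)
    Near k u v = Σ[ as ∈ List Vertex ]
                   (k ≤ length as) ×
                   AllPairs (λ a b → ¬ SameVertex a b) as ×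
                   All (λ a → VertexOf u a × VertexOf v a) as

    data Consecutive (k : ℕ) : List Carrier → Set (c ⊔ ℓ) where
      single : ∀ x → Consecutive k (x ∷ [])
      cons   : ∀ x y xs → Near k x y → Consecutive k (y ∷ xs) → Consecutive k (x ∷ y ∷ xs)

    data EndsAtσ₀ : List Carrier → Set (c ⊔ ℓ) where
      here  : ∀ x → x ≈ ε → EndsAtσ₀ (x ∷ [])
      there : ∀ x y xs → EndsAtσ₀ (y ∷ xs) → EndsAtσ₀ (x ∷ y ∷ xs)

    data StartsAtσ₀ : List Carrier → Set (c ⊔ ℓ) where
      start : ∀ x xs → x ≈ ε → StartsAtσ₀ (x ∷ xs)

    -- a loop based at σ₀ whose consecutive entries share ≥ k vertices
    -- (an (k-1)-loop)
    IsLoop : ℕ → List Carrier → Set (c ⊔ ℓ)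
    IsLoop k xs = StartsAtσ₀ xs × EndsAtσ₀ xs × Consecutive k xs

    -- elementary moves generating ≃_q (with k = q + 1):
    -- stretching, and one step of a homotopy grid (two loops of equal
    -- length, entries in the same position k-near).
    data HomStep (k : ℕ) : List Carrier → List Carrier → Set (c ⊔ ℓ) where
      stretch : ∀ xs a ys → IsLoop k (xs ++ a ∷ ys) →
                HomStep k (xs ++ a ∷ ys) (xs ++ a ∷ a ∷ ys)
      grid    : ∀ xs ys → IsLoop k xs → IsLoop k ys →
                Pointwise (Near k) xs ys → HomStep k xs ys

    Homotopic : ℕ → List Carrier → List Carrier → Set (c ⊔ ℓ)
    Homotopic k = EqClosure (HomStep k)

    chain : Carrier → List (Fin n) → List Carrier
    chain acc []      = acc ∷ []
    chain acc (s ∷ w) = acc ∷ chain (acc ∙ gen s) w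

    g : List (Fin n) → List Carrier
    g = chain ε

module Submission where

-- Each defining relation of W′ changes the gallery g(w) only locally: deleting
-- a letter pair s s, or swapping commuting letters s t, is realised by stretchings
-- and homotopy grids.  Viewing a gallery as a list of steps (cross a wall, or
-- pause) makes every intermediate list a gallery, so all loop conditions come
-- from one lemma ('gallery-loop'); the grids need that consecutive chambers share
-- n - 1 vertices ('adjacent⇒near').  That last fact is where the Coxeter theory
-- enters: the vertices u·W_{S∖{r}} of a chamber u are pairwise distinct because
-- no generator r lies in W_{S∖{r}} ('generator-not-in-parabolic').

open import Defs
open import Level using (Level; _⊔_; Lift; lift; lower)
open import Function using (_∘_)
open import Function.Bundles using (mk⇔)
open import Algebra.Bundles using (Group)
open import Algebra.Morphism.Structures using (IsGroupHomomorphism)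
import Algebra.Properties.Group as GroupProperties
open import Data.Nat using (ℕ; zero; suc; _+_; _∸_; _≤_; _<_; s≤s)
open import Data.Nat.Properties using (+-suc; ≤-trans; ≤-pred; ≤-reflexive; m∸n≤m)
open import Data.Fin using (Fin; zero; suc; punchIn)
open import Data.Fin.Properties using (punchIn-injective; punchInᵢ≢i)
open import Data.Bool using (Bool; true; false; _xor_)
open import Data.Bool.Properties using (xor-assoc; xor-same; xor-identityʳ)
open import Data.Maybe using (Maybe; just; nothing)
open import Data.Product using (_×_; _,_; proj₁; proj₂; Σ-syntax)
open import Data.Product.Relation.Binary.Pointwise.NonDependent using (×-setoid)
open import Data.Sum using (_⊎_; inj₁; inj₂)
open import Data.List using (List; []; _∷_; _++_; map; length; reverse; tabulate; allFin)
open import Data.List.Properties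
  using (map-++; ++-assoc; ++-identityʳ; unfold-reverse; length-map; length-tabulate)
open import Data.List.Relation.Unary.All as All using (All; []; _∷_)
import Data.List.Relation.Unary.All.Properties as AllProperties
open import Data.List.Relation.Unary.AllPairs as AllPairs using (AllPairs; []; _∷_)
import Data.List.Relation.Unary.AllPairs.Properties as AllPairsProperties
open import Data.List.Relation.Unary.Any as Any using (Any; here; there)
import Data.List.Relation.Unary.Any.Properties as AnyProperties
open import Data.List.Relation.Unary.Unique.Propositional using (Unique)
import Data.List.Relation.Unary.Unique.Propositional.Properties as UniqueProperties
open import Data.List.Relation.Binary.Pointwise as Pw using (Pointwise; []; _∷_)
open import Data.List.Relation.Binary.Sublist.Propositional using (_⊆_; _∷_; _∷ʳ_; ⊆-refl)
open import Data.List.Relation.Binary.Sublist.Propositional.Properties using (++⁺; All-resp-⊆)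
open import Data.List.Relation.Binary.Sublist.Heterogeneous.Properties using (length-mono-≤)
open import Relation.Nullary using (¬_; Dec; does; yes; no)
open import Relation.Nullary.Decidable using (dec-true; dec-false; does-⇔; ¬¬-excluded-middle)
open import Relation.Nullary.Negation using (¬¬-map)
open import Relation.Binary.Bundles using (Setoid)
open import Relation.Binary.Structures using (IsEquivalence)
open import Relation.Binary.PropositionalEquality as ≡ using (_≡_; _≢_)
import Relation.Binary.Construct.Closure.Equivalence as EqClosure
import Relation.Binary.Reasoning.Setoid as SetoidReasoning

module Involutions {c ℓ : Level} {n : ℕ} (W : Group c ℓ) (gen : Fin n → Group.Carrier W)
         (involution : ∀ s → Group._≈_ W (Group._∙_ W (gen s) (gen s)) (Group.ε W)) where

  open Group W
  open GroupProperties W using (inverseʳ-unique; ⁻¹-anti-homo-∙)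
  open SetoidReasoning setoid

  ⟦_⟧ : List (Fin n) → Carrier
  ⟦_⟧ = eval W gen

  ⟦⟧-++ : ∀ u v → ⟦ u ++ v ⟧ ≈ ⟦ u ⟧ ∙ ⟦ v ⟧
  ⟦⟧-++ []      v = sym (identityˡ _)
  ⟦⟧-++ (s ∷ u) v = trans (∙-congˡ (⟦⟧-++ u v)) (sym (assoc _ _ _))

  gen-cancelʳ : ∀ x s → (x ∙ gen s) ∙ gen s ≈ x
  gen-cancelʳ x s = begin
    (x ∙ gen s) ∙ gen s  ≈⟨ assoc _ _ _ ⟩
    x ∙ (gen s ∙ gen s)  ≈⟨ ∙-congˡ (involution s) ⟩
    x ∙ ε                ≈⟨ identityʳ x ⟩
    x                    ∎

  gen-cancelˡ : ∀ s x → gen s ∙ (gen s ∙ x) ≈ x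
  gen-cancelˡ s x = begin
    gen s ∙ (gen s ∙ x)  ≈⟨ assoc _ _ _ ⟨
    (gen s ∙ gen s) ∙ x  ≈⟨ ∙-congʳ (involution s) ⟩
    ε ∙ x                ≈⟨ identityˡ x ⟩
    x                    ∎

  order-two-commute : ∀ s t → m[_,_]≡_ W gen s t 2 → gen s ∙ gen t ≈ gen t ∙ gen s
  order-two-commute s t (_ , square , _) = begin
    gen s ∙ gen t            ≈⟨ inverseʳ-unique (gen s ∙ gen t) _ square′ ⟩
    (gen s ∙ gen t) ⁻¹       ≈⟨ ⁻¹-anti-homo-∙ (gen s) (gen t) ⟩
    gen t ⁻¹ ∙ gen s ⁻¹      ≈⟨ ∙-cong (self-inverse t) (self-inverse s) ⟨
    gen t ∙ gen s            ∎
    where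
    square′ : (gen s ∙ gen t) ∙ (gen s ∙ gen t) ≈ ε
    square′ = trans (∙-congˡ (sym (identityʳ _))) square
    self-inverse : ∀ r → gen r ≈ gen r ⁻¹
    self-inverse r = inverseʳ-unique (gen r) (gen r) (involution r)

  W'Step-sound : ∀ {w v} → W'Step W gen w v → ⟦ w ⟧ ≈ ⟦ v ⟧
  W'Step-sound (cancel xs ys s) = begin
    ⟦ xs ++ s ∷ s ∷ ys ⟧          ≈⟨ ⟦⟧-++ xs (s ∷ s ∷ ys) ⟩
    ⟦ xs ⟧ ∙ ⟦ s ∷ s ∷ ys ⟧       ≈⟨ ∙-congˡ (gen-cancelˡ s ⟦ ys ⟧) ⟩
    ⟦ xs ⟧ ∙ ⟦ ys ⟧               ≈⟨ ⟦⟧-++ xs ys ⟨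
    ⟦ xs ++ ys ⟧                  ∎
  W'Step-sound (commute xs ys s t m≡2) = begin
    ⟦ xs ++ s ∷ t ∷ ys ⟧                 ≈⟨ ⟦⟧-++ xs (s ∷ t ∷ ys) ⟩
    ⟦ xs ⟧ ∙ (gen s ∙ (gen t ∙ ⟦ ys ⟧))  ≈⟨ ∙-congˡ (assoc _ _ _) ⟨
    ⟦ xs ⟧ ∙ ((gen s ∙ gen t) ∙ ⟦ ys ⟧)  ≈⟨ ∙-congˡ (∙-congʳ (order-two-commute s t m≡2)) ⟩
    ⟦ xs ⟧ ∙ ((gen t ∙ gen s) ∙ ⟦ ys ⟧)  ≈⟨ ∙-congˡ (assoc _ _ _) ⟩
    ⟦ xs ⟧ ∙ (gen t ∙ (gen s ∙ ⟦ ys ⟧))  ≈⟨ ⟦⟧-++ xs (t ∷ s ∷ ys) ⟨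
    ⟦ xs ++ t ∷ s ∷ ys ⟧                 ∎

  conj : Fin n → Carrier → Carrier
  conj s y = (gen s ∙ y) ∙ gen s

  conj-cong : ∀ s {x y} → x ≈ y → conj s x ≈ conj s y
  conj-cong s x≈y = ∙-congʳ (∙-congˡ x≈y)

  conj-involutive : ∀ s x → conj s (conj s x) ≈ x
  conj-involutive s x = begin
    (gen s ∙ ((gen s ∙ x) ∙ gen s)) ∙ gen s  ≈⟨ assoc _ _ _ ⟩
    gen s ∙ (((gen s ∙ x) ∙ gen s) ∙ gen s)  ≈⟨ ∙-congˡ (gen-cancelʳ _ s) ⟩
    gen s ∙ (gen s ∙ x)                      ≈⟨ gen-cancelˡ s x ⟩
    x                                        ∎

  conj-transpose : ∀ s {x y} → x ≈ conj s y → conj s x ≈ y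
  conj-transpose s {x} {y} x≈sys = trans (conj-cong s x≈sys) (conj-involutive s y)

  conj-injective : ∀ s {x y} → conj s x ≈ conj s y → x ≈ y
  conj-injective s {x} {y} sxs≈sys = trans (sym (conj-involutive s x)) (conj-transpose s sxs≈sys)

  conj-gen : ∀ s → conj s (gen s) ≈ gen s
  conj-gen s = gen-cancelʳ (gen s) s

  conjBy : List (Fin n) → Carrier → Carrier
  conjBy []      y = y
  conjBy (s ∷ u) y = conj s (conjBy u y)

  conjBy-∙ : ∀ u y → conjBy u y ∙ ⟦ u ⟧ ≈ ⟦ u ⟧ ∙ y
  conjBy-∙ []      y = trans (identityʳ y) (sym (identityˡ y))
  conjBy-∙ (s ∷ u) y = begin
    ((gen s ∙ conjBy u y) ∙ gen s) ∙ (gen s ∙ ⟦ u ⟧)  ≈⟨ assoc _ _ _ ⟩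
    (gen s ∙ conjBy u y) ∙ (gen s ∙ (gen s ∙ ⟦ u ⟧))  ≈⟨ ∙-congˡ (gen-cancelˡ s ⟦ u ⟧) ⟩
    (gen s ∙ conjBy u y) ∙ ⟦ u ⟧                      ≈⟨ assoc _ _ _ ⟩
    gen s ∙ (conjBy u y ∙ ⟦ u ⟧)                      ≈⟨ ∙-congˡ (conjBy-∙ u y) ⟩
    gen s ∙ (⟦ u ⟧ ∙ y)                               ≈⟨ assoc _ _ _ ⟨
    (gen s ∙ ⟦ u ⟧) ∙ y                               ∎

  deletion : ∀ s u t v → gen s ≈ conjBy u (gen t) → ⟦ s ∷ u ++ t ∷ v ⟧ ≈ ⟦ u ++ v ⟧
  deletion s u t v s≈utu = begin
    gen s ∙ ⟦ u ++ t ∷ v ⟧                   ≈⟨ ∙-congˡ (⟦⟧-++ u (t ∷ v)) ⟩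
    gen s ∙ (⟦ u ⟧ ∙ (gen t ∙ ⟦ v ⟧))         ≈⟨ assoc _ _ _ ⟨
    (gen s ∙ ⟦ u ⟧) ∙ (gen t ∙ ⟦ v ⟧)         ≈⟨ ∙-congʳ (trans (∙-congʳ s≈utu) (conjBy-∙ u (gen t))) ⟩
    (⟦ u ⟧ ∙ gen t) ∙ (gen t ∙ ⟦ v ⟧)         ≈⟨ assoc _ _ _ ⟩
    ⟦ u ⟧ ∙ (gen t ∙ (gen t ∙ ⟦ v ⟧))         ≈⟨ ∙-congˡ (gen-cancelˡ t ⟦ v ⟧) ⟩
    ⟦ u ⟧ ∙ ⟦ v ⟧                             ≈⟨ ⟦⟧-++ u v ⟨
    ⟦ u ++ v ⟧                                ∎

  -- The reflections t₁ = s₁, t₂ = s₁s₂s₁, …, tᵢ = s₁⋯sᵢ⋯s₁ crossed by the word s₁⋯sₖ.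
  reflections : List (Fin n) → List Carrier
  reflections []      = []
  reflections (s ∷ u) = gen s ∷ map (conj s) (reflections u)

  reflections-split : ∀ {p} (P : Carrier → Set p) w → Any P (reflections w) →
                      Σ[ u ∈ List (Fin n) ] Σ[ t ∈ Fin n ] Σ[ v ∈ List (Fin n) ]
                        (w ≡ u ++ t ∷ v) × P (conjBy u (gen t))
  reflections-split P (s ∷ w) (here p) = [] , s , w , ≡.refl , p
  reflections-split P (s ∷ w) (there p)
    with reflections-split (λ y → P (conj s y)) w (AnyProperties.map⁻ p)
  ... | u , t , v , ≡.refl , q = s ∷ u , t , v , ≡.refl , q

  _≋_ : List Carrier → List Carrier → Set (c ⊔ ℓ)
  _≋_ = Pointwise _≈_

  ≋-trans : ∀ {xs ys zs} → xs ≋ ys → ys ≋ zs → xs ≋ zs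
  ≋-trans = Pw.transitive trans

  double : ℕ → ℕ
  double zero    = zero
  double (suc m) = suc (suc (double m))

  double≡m+m : ∀ m → double m ≡ m + m
  double≡m+m zero    = ≡.refl
  double≡m+m (suc m) = ≡.cong suc (≡.trans (≡.cong suc (double≡m+m m)) (≡.sym (+-suc m m)))

  alternating : Fin n → Fin n → ℕ → List (Fin n)
  alternating a b zero    = []
  alternating a b (suc k) = a ∷ alternating b a k

  ⟦alternating⟧ : ∀ a b m → ⟦ alternating a b (double m) ⟧ ≈ pow W (gen a ∙ gen b) m
  ⟦alternating⟧ a b zero    = refl
  ⟦alternating⟧ a b (suc m) = trans (∙-congˡ (∙-congˡ (⟦alternating⟧ a b m))) (sym (assoc _ _ _))

  -- the j-th reflection (ab)ʲa of an alternating word, i.e. the palindrome a b ⋯ b a of length 2j+1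
  dihedral : Fin n → Fin n → ℕ → Carrier
  dihedral a b j = ⟦ alternating a b (suc (double j)) ⟧

  dihedral-conj : ∀ a b j → conj a (dihedral b a j) ≈ dihedral a b (suc j)
  dihedral-conj a b j = begin
    (gen a ∙ dihedral b a j) ∙ gen a                           ≈⟨ ∙-congˡ (identityʳ (gen a)) ⟨
    ⟦ alternating a b (double (suc j)) ⟧ ∙ ⟦ a ∷ [] ⟧          ≈⟨ ⟦⟧-++ (alternating a b (double (suc j))) (a ∷ []) ⟨
    ⟦ alternating a b (double (suc j)) ++ a ∷ [] ⟧             ≡⟨ ≡.cong ⟦_⟧ (append-a (suc j)) ⟩
    dihedral a b (suc j)                                       ∎
    where
    append-a : ∀ m → alternating a b (double m) ++ a ∷ [] ≡ alternating a b (suc (double m))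
    append-a zero    = ≡.refl
    append-a (suc m) = ≡.cong (λ w → a ∷ b ∷ w) (append-a m)

  dihedral-period : ∀ a b m → pow W (gen a ∙ gen b) m ≈ ε → ∀ i → dihedral a b (m + i) ≈ dihedral a b i
  dihedral-period a b m ab^m≈ε i = begin
    ⟦ alternating a b (suc (double (m + i))) ⟧                 ≡⟨ ≡.cong ⟦_⟧ (split m) ⟩
    ⟦ alternating a b (double m) ++ alternating a b (suc (double i)) ⟧
                                                               ≈⟨ ⟦⟧-++ (alternating a b (double m)) _ ⟩
    ⟦ alternating a b (double m) ⟧ ∙ dihedral a b i            ≈⟨ ∙-congʳ (trans (⟦alternating⟧ a b m) ab^m≈ε) ⟩
    ε ∙ dihedral a b i                                         ≈⟨ identityˡ _ ⟩
    dihedral a b i                                             ∎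
    where
    split : ∀ m → alternating a b (suc (double (m + i)))
                    ≡ alternating a b (double m) ++ alternating a b (suc (double i))
    split zero    = ≡.refl
    split (suc m) = ≡.cong (λ w → a ∷ b ∷ w) (split m)

  dihedrals : Fin n → Fin n → ℕ → ℕ → List Carrier
  dihedrals a b j zero    = []
  dihedrals a b j (suc k) = dihedral a b j ∷ dihedrals a b (suc j) k

  reflections-alternating : ∀ k a b → reflections (alternating a b k) ≋ dihedrals a b 0 k
  reflections-alternating zero    a b = []
  reflections-alternating (suc k) a b =
    sym (identityʳ _) ∷ ≋-trans (Pw.map⁺ (conj a) (conj a) (Pw.map (conj-cong a) (reflections-alternating k b a)))
                                (shift 0 k)
    where
    shift : ∀ j k → map (conj a) (dihedrals b a j k) ≋ dihedrals a b (suc j) k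
    shift j zero    = []
    shift j (suc k) = dihedral-conj a b j ∷ shift (suc j) k

  dihedrals-++ : ∀ a b m k j → dihedrals a b j (m + k) ≡ dihedrals a b j m ++ dihedrals a b (m + j) k
  dihedrals-++ a b zero    k j = ≡.refl
  dihedrals-++ a b (suc m) k j = ≡.cong (dihedral a b j ∷_)
    (≡.trans (dihedrals-++ a b m k (suc j)) (≡.cong (λ i → dihedrals a b (suc j) m ++ dihedrals a b i k) (+-suc m j)))

  dihedrals-period : ∀ a b m → pow W (gen a ∙ gen b) m ≈ ε → ∀ k j → dihedrals a b (m + j) k ≋ dihedrals a b j k
  dihedrals-period a b m ab^m≈ε zero    j = []
  dihedrals-period a b m ab^m≈ε (suc k) j =
    dihedral-period a b m ab^m≈ε j
      ∷ ≡.subst (λ i → dihedrals a b i k ≋ dihedrals a b (suc j) k) (+-suc m j)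
                (dihedrals-period a b m ab^m≈ε k (suc j))

-- Tits' reflection cocycle for a group generated by involutions, with decidable
-- equality: η(w, x) counts, modulo 2, how often the word w crosses the reflection x.
-- For a finite Coxeter system η depends only on the element ⟦ w ⟧, which yields
-- the deletion argument behind 'generator-not-in-parabolic'.
module ReflectionCocycle {c ℓ : Level} {n : ℕ} (W : Group c ℓ) (gen : Fin n → Group.Carrier W)
         (involution : ∀ s → Group._≈_ W (Group._∙_ W (gen s) (gen s)) (Group.ε W))
         (_≟_ : ∀ x y → Dec (Group._≈_ W x y)) where

  open Group W
  open Involutions W gen involution

  _≟ᵇ_ : Carrier → Carrier → Bool
  x ≟ᵇ y = does (x ≟ y)

  ≟ᵇ-cong : ∀ {x x′ y y′} → x ≈ y → x′ ≈ y′ → (x ≟ᵇ x′) ≡ (y ≟ᵇ y′)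
  ≟ᵇ-cong x≈y x′≈y′ = does-⇔ (mk⇔ (λ e → trans (sym x≈y) (trans e x′≈y′))
                                  (λ e → trans x≈y (trans e (sym x′≈y′)))) (_ ≟ _) (_ ≟ _)

  ≟ᵇ-sound : ∀ {x y} → (x ≟ᵇ y) ≡ true → x ≈ y
  ≟ᵇ-sound {x} {y} x≟y with x ≟ y | x≟y
  ... | yes x≈y | _  = x≈y
  ... | no  _   | ()

  occurs : List Carrier → Carrier → Bool
  occurs []       x = false
  occurs (y ∷ ys) x = (x ≟ᵇ y) xor occurs ys x

  occurs-++ : ∀ xs ys x → occurs (xs ++ ys) x ≡ occurs xs x xor occurs ys x
  occurs-++ []       ys x = ≡.refl
  occurs-++ (y ∷ xs) ys x = ≡.trans (≡.cong ((x ≟ᵇ y) xor_) (occurs-++ xs ys x)) (≡.sym (xor-assoc (x ≟ᵇ y) _ _))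

  occurs-≋ : ∀ {xs ys} x → xs ≋ ys → occurs xs x ≡ occurs ys x
  occurs-≋ x []           = ≡.refl
  occurs-≋ x (y≈z ∷ xs≋ys) = ≡.cong₂ _xor_ (≟ᵇ-cong refl y≈z) (occurs-≋ x xs≋ys)

  occurs-conj : ∀ s ys x → occurs (map (conj s) ys) x ≡ occurs ys (conj s x)
  occurs-conj s []       x = ≡.refl
  occurs-conj s (y ∷ ys) x = ≡.cong₂ _xor_
    (does-⇔ (mk⇔ (conj-transpose s) (λ e → trans (sym (conj-involutive s x)) (conj-cong s e))) (_ ≟ _) (_ ≟ _))
    (occurs-conj s ys x)

  occurs-absent : ∀ {ys x} → All (λ y → ¬ x ≈ y) ys → occurs ys x ≡ false
  occurs-absent []            = ≡.refl
  occurs-absent (x≉y ∷ x∉ys) = ≡.cong₂ _xor_ (dec-false (_ ≟ _) x≉y) (occurs-absent x∉ys)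

  parity : List (Fin n) → Carrier → Bool
  parity w x = occurs (reflections w) x

  parity-∷ : ∀ s w x → parity (s ∷ w) x ≡ (x ≟ᵇ gen s) xor parity w (conj s x)
  parity-∷ s w x = ≡.cong ((x ≟ᵇ gen s) xor_) (occurs-conj s (reflections w) x)

  -- if (ab)ᵐ = 1, the word (ab)ᵐ crosses each of its reflections twice
  parity-braid : ∀ a b m → pow W (gen a ∙ gen b) m ≈ ε → ∀ x → parity (alternating a b (double m)) x ≡ false
  parity-braid a b m ab^m≈ε x = begin
    occurs (reflections (alternating a b (double m))) x    ≡⟨ occurs-≋ x (reflections-alternating (double m) a b) ⟩
    occurs (dihedrals a b 0 (double m)) x                  ≡⟨ ≡.cong (λ k → occurs (dihedrals a b 0 k) x) (double≡m+m m) ⟩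
    occurs (dihedrals a b 0 (m + m)) x                     ≡⟨ ≡.cong (λ ys → occurs ys x) (dihedrals-++ a b m m 0) ⟩
    occurs (firstHalf ++ dihedrals a b (m + 0) m) x        ≡⟨ occurs-++ firstHalf _ x ⟩
    occurs firstHalf x xor occurs (dihedrals a b (m + 0) m) x
      ≡⟨ ≡.cong (occurs firstHalf x xor_) (occurs-≋ x (dihedrals-period a b m ab^m≈ε m 0)) ⟩
    occurs firstHalf x xor occurs firstHalf x              ≡⟨ xor-same (occurs firstHalf x) ⟩
    false                                                  ∎
    where
    open ≡.≡-Reasoning
    firstHalf : List Carrier
    firstHalf = dihedrals a b 0 m

  -- The Tits action of S on reflections × signs:  s·(x , e) = (s x s , e + [x = s]).
  Point : Set c
  Point = Carrier × Bool

  open Setoid (×-setoid setoid (≡.setoid Bool))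
    using () renaming (_≈_ to _≈ₚ_; refl to ≈ₚ-refl; sym to ≈ₚ-sym; trans to ≈ₚ-trans; reflexive to ≈ₚ-reflexive)

  reflect : Fin n → Point → Point
  reflect s (x , e) = conj s x , e xor (x ≟ᵇ gen s)

  reflect-cong : ∀ s {p q} → p ≈ₚ q → reflect s p ≈ₚ reflect s q
  reflect-cong s (x≈y , e≡e′) = conj-cong s x≈y , ≡.cong₂ _xor_ e≡e′ (≟ᵇ-cong x≈y refl)

  reflect-involutive : ∀ s p → reflect s (reflect s p) ≈ₚ p
  reflect-involutive s (x , e) = conj-involutive s x , (begin
    (e xor (x ≟ᵇ gen s)) xor (conj s x ≟ᵇ gen s)  ≡⟨ ≡.cong ((e xor (x ≟ᵇ gen s)) xor_) same-test ⟩
    (e xor (x ≟ᵇ gen s)) xor (x ≟ᵇ gen s)         ≡⟨ xor-assoc e _ _ ⟩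
    e xor ((x ≟ᵇ gen s) xor (x ≟ᵇ gen s))         ≡⟨ ≡.cong (e xor_) (xor-same (x ≟ᵇ gen s)) ⟩
    e xor false                                   ≡⟨ xor-identityʳ e ⟩
    e                                             ∎)
    where
    open ≡.≡-Reasoning
    same-test : (conj s x ≟ᵇ gen s) ≡ (x ≟ᵇ gen s)
    same-test = does-⇔ (mk⇔ (λ e → trans (sym (conj-involutive s x)) (trans (conj-cong s e) (conj-gen s)))
                            (λ e → trans (conj-cong s e) (conj-gen s))) (_ ≟ _) (_ ≟ _)

  act : List (Fin n) → Point → Point
  act []      p = p
  act (s ∷ w) p = act w (reflect s p)

  act-cong : ∀ w {p q} → p ≈ₚ q → act w p ≈ₚ act w q
  act-cong []      p≈q = p≈q
  act-cong (s ∷ w) p≈q = act-cong w (reflect-cong s p≈q)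

  act-++ : ∀ u v p → act (u ++ v) p ≡ act v (act u p)
  act-++ []      v p = ≡.refl
  act-++ (s ∷ u) v p = act-++ u v (reflect s p)

  act-reflection : ∀ w x e → ⟦ w ⟧ ∙ proj₁ (act w (x , e)) ≈ x ∙ ⟦ w ⟧
  act-reflection []      x e = trans (identityˡ x) (sym (identityʳ x))
  act-reflection (s ∷ w) x e = begin
    (gen s ∙ ⟦ w ⟧) ∙ proj₁ (act w (conj s x , _))  ≈⟨ assoc _ _ _ ⟩
    gen s ∙ (⟦ w ⟧ ∙ proj₁ (act w (conj s x , _)))  ≈⟨ ∙-congˡ (act-reflection w (conj s x) _) ⟩
    gen s ∙ (((gen s ∙ x) ∙ gen s) ∙ ⟦ w ⟧)         ≈⟨ ∙-congˡ (assoc _ _ _) ⟩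
    gen s ∙ ((gen s ∙ x) ∙ (gen s ∙ ⟦ w ⟧))         ≈⟨ assoc _ _ _ ⟨
    (gen s ∙ (gen s ∙ x)) ∙ (gen s ∙ ⟦ w ⟧)         ≈⟨ ∙-congʳ (gen-cancelˡ s x) ⟩
    x ∙ (gen s ∙ ⟦ w ⟧)                             ∎
    where open SetoidReasoning setoid

  act-sign : ∀ w x e → proj₂ (act w (x , e)) ≡ e xor parity w x
  act-sign []      x e = ≡.sym (xor-identityʳ e)
  act-sign (s ∷ w) x e = begin
    proj₂ (act w (conj s x , e xor (x ≟ᵇ gen s)))  ≡⟨ act-sign w (conj s x) _ ⟩
    (e xor (x ≟ᵇ gen s)) xor parity w (conj s x)   ≡⟨ xor-assoc e _ _ ⟩
    e xor ((x ≟ᵇ gen s) xor parity w (conj s x))   ≡⟨ ≡.cong (e xor_) (parity-∷ s w x) ⟨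
    e xor parity (s ∷ w) x                         ∎
    where open ≡.≡-Reasoning

  act-trivial : ∀ w → ⟦ w ⟧ ≈ ε → (∀ x → parity w x ≡ false) → ∀ p → act w p ≈ₚ p
  act-trivial w w≈ε even (x , e) =
    reflection-fixed , ≡.trans (act-sign w x e) (≡.trans (≡.cong (e xor_) (even x)) (xor-identityʳ e))
    where
    open SetoidReasoning setoid
    reflection-fixed : proj₁ (act w (x , e)) ≈ x
    reflection-fixed = begin
      proj₁ (act w (x , e))          ≈⟨ identityˡ _ ⟨
      ε ∙ proj₁ (act w (x , e))      ≈⟨ ∙-congʳ w≈ε ⟨
      ⟦ w ⟧ ∙ proj₁ (act w (x , e))  ≈⟨ act-reflection w x e ⟩
      x ∙ ⟦ w ⟧                      ≈⟨ ∙-congˡ w≈ε ⟩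
      x ∙ ε                          ≈⟨ identityʳ x ⟩
      x                              ∎

  act-reverse-∷ : ∀ s w p → act (reverse (s ∷ w)) p ≡ reflect s (act (reverse w) p)
  act-reverse-∷ s w p = ≡.trans (≡.cong (λ u → act u p) (unfold-reverse s w)) (act-++ (reverse w) (s ∷ []) p)

  act-reverseˡ : ∀ w p → act (reverse w) (act w p) ≈ₚ p
  act-reverseˡ []      p = ≈ₚ-refl
  act-reverseˡ (s ∷ w) p =
    ≈ₚ-trans (≈ₚ-reflexive (act-reverse-∷ s w _))
      (≈ₚ-trans (reflect-cong s (act-reverseˡ w (reflect s p))) (reflect-involutive s p))

  act-reverseʳ : ∀ w p → act w (act (reverse w) p) ≈ₚ p
  act-reverseʳ []      p = ≈ₚ-refl
  act-reverseʳ (s ∷ w) p =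
    ≈ₚ-trans (act-cong w (reflect-cong s (≈ₚ-reflexive (act-reverse-∷ s w p))))
      (≈ₚ-trans (act-cong w (reflect-involutive s _)) (act-reverseʳ w p))

  -- Finiteness of
  -- W lets us test the action on the finitely many points (xᵢ , e), which keeps
  -- the equality of this group in universe level ℓ, as the universal property of
  -- the Coxeter presentation demands.
  module ActionGroup (finite : IsFinite W) where

    private
      element : Fin (proj₁ finite) → Carrier
      element = proj₁ (proj₂ finite)

      index : ∀ x → Σ[ i ∈ Fin (proj₁ finite) ] x ≈ element i
      index = proj₂ (proj₂ finite)

    Word : Set c
    Word = Lift c (List (Fin n))

    _∼_ : Word → Word → Set ℓ
    u ∼ v = ∀ i e → act (lower u) (element i , e) ≈ₚ act (lower v) (element i , e)

    ∼-everywhere : ∀ {u v} → u ∼ v → ∀ p → act (lower u) p ≈ₚ act (lower v) p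
    ∼-everywhere {u} {v} u∼v (x , e) with index x
    ... | i , x≈xᵢ = ≈ₚ-trans (act-cong (lower u) (x≈xᵢ , ≡.refl))
                       (≈ₚ-trans (u∼v i e) (act-cong (lower v) (sym x≈xᵢ , ≡.refl)))

    ∼-reflexive : ∀ {u v} → lower u ≡ lower v → u ∼ v
    ∼-reflexive ≡.refl i e = ≈ₚ-refl

    _·_ : Word → Word → Word
    u · v = lift (lower u ++ lower v)

    ·-cong : ∀ {u u′ v v′} → u ∼ u′ → v ∼ v′ → (u · v) ∼ (u′ · v′)
    ·-cong {u} {u′} {v} {v′} u∼u′ v∼v′ i e =
      ≈ₚ-trans (≈ₚ-reflexive (act-++ (lower u) (lower v) _))
        (≈ₚ-trans (act-cong (lower v) (u∼u′ i e))
          (≈ₚ-trans (∼-everywhere {v} {v′} v∼v′ _) (≈ₚ-reflexive (≡.sym (act-++ (lower u′) (lower v′) _)))))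

    reversal : Word → Word
    reversal u = lift (reverse (lower u))

    reversal-cong : ∀ {u v} → u ∼ v → reversal u ∼ reversal v
    reversal-cong {u} {v} u∼v i e =
      ≈ₚ-trans (act-cong (reverse (lower u)) (≈ₚ-sym (act-reverseʳ (lower v) p)))
        (≈ₚ-trans (act-cong (reverse (lower u)) (≈ₚ-sym (∼-everywhere {u} {v} u∼v (act (reverse (lower v)) p))))
          (act-reverseˡ (lower u) (act (reverse (lower v)) p)))
      where
      p : Point
      p = element i , e

    actionGroup : Group c ℓ
    actionGroup = record
      { Carrier = Word ; _≈_ = _∼_ ; _∙_ = _·_ ; ε = lift [] ; _⁻¹ = reversal
      ; isGroup = record
        { isMonoid = record
          { isSemigroup = record
            { isMagma = record
              { isEquivalence = record
                { refl  = λ i e → ≈ₚ-refl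
                ; sym   = λ u∼v i e → ≈ₚ-sym (u∼v i e)
                ; trans = λ u∼v v∼w i e → ≈ₚ-trans (u∼v i e) (v∼w i e) }
              ; ∙-cong = λ {u} {u′} {v} {v′} → ·-cong {u} {u′} {v} {v′} }
            ; assoc = λ u v w → ∼-reflexive {(u · v) · w} {u · (v · w)} (++-assoc (lower u) (lower v) (lower w)) }
          ; identity = (λ u → ∼-reflexive {lift [] · u} {u} ≡.refl)
                     , (λ u → ∼-reflexive {u · lift []} {u} (++-identityʳ (lower u))) }
        ; inverse = (λ u i e → ≈ₚ-trans (≈ₚ-reflexive (act-++ (reverse (lower u)) (lower u) _)) (act-reverseʳ (lower u) _))
                  , (λ u i e → ≈ₚ-trans (≈ₚ-reflexive (act-++ (lower u) (reverse (lower u)) _)) (act-reverseˡ (lower u) _))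
        ; ⁻¹-cong = λ {u} {v} → reversal-cong {u} {v} } }

    letter : Fin n → Word
    letter s = lift (s ∷ [])

    letter-braid : ∀ s t m → lower (pow actionGroup (letter s · letter t) m) ≡ alternating s t (double m)
    letter-braid s t zero    = ≡.refl
    letter-braid s t (suc m) = ≡.cong (λ w → s ∷ t ∷ w) (letter-braid s t m)

    braid-relation : ∀ s t m → m[_,_]≡_ W gen s t m →
                     pow actionGroup (letter s · letter t) m ∼ lift []
    braid-relation s t m (_ , st^m≈ε , _) i e rewrite letter-braid s t m =
      act-trivial (alternating s t (double m)) (trans (⟦alternating⟧ s t m) st^m≈ε)
                  (parity-braid s t m st^m≈ε) (element i , e)

    action-well-defined : IsCoxeterSystem W gen → ∀ {w v} → ⟦ w ⟧ ≈ ⟦ v ⟧ → lift w ∼ lift v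
    action-well-defined cox {w} {v} w≈v with IsCoxeterSystem.universal cox actionGroup letter braid-relation
    ... | φ , φ-homomorphism , φ-letter =
      ∼-trans {lift w} {φ ⟦ w ⟧} {lift v} (∼-sym {φ ⟦ w ⟧} {lift w} (φ-⟦⟧ w))
        (∼-trans {φ ⟦ w ⟧} {φ ⟦ v ⟧} {lift v} (⟦⟧-cong w≈v) (φ-⟦⟧ v))
      where
      open IsGroupHomomorphism φ-homomorphism using (homo; ε-homo; ⟦⟧-cong)
      open Group actionGroup using () renaming (trans to ∼-trans; sym to ∼-sym)
      φ-⟦⟧ : ∀ u → φ ⟦ u ⟧ ∼ lift u
      φ-⟦⟧ []      = ε-homo
      φ-⟦⟧ (s ∷ u) = ∼-trans {φ ⟦ s ∷ u ⟧} {φ (gen s) · φ ⟦ u ⟧} {lift (s ∷ u)} (homo (gen s) ⟦ u ⟧)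
                       (·-cong {φ (gen s)} {letter s} {φ ⟦ u ⟧} {lift u} (φ-letter s) (φ-⟦⟧ u))

  parity-invariant : IsFinite W → IsCoxeterSystem W gen →
                     ∀ {w v} → ⟦ w ⟧ ≈ ⟦ v ⟧ → ∀ x → parity w x ≡ parity v x
  parity-invariant finite cox {w} {v} w≈v x =
    ≡.trans (≡.sym (act-sign w x false))
      (≡.trans (proj₂ (∼-everywhere {lift w} {lift v} (action-well-defined cox {w} {v} w≈v) (x , false)))
               (act-sign v x false))
    where open ActionGroup finite

  Reducible : List (Fin n) → Set ℓ
  Reducible w = Σ[ w′ ∈ List (Fin n) ] w′ ⊆ w × length w′ < length w × ⟦ w′ ⟧ ≈ ⟦ w ⟧

  reducible-∷ : ∀ s {w} → Reducible w → Reducible (s ∷ w)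
  reducible-∷ s (w′ , w′⊆w , shorter , w′≈w) = s ∷ w′ , ≡.refl ∷ w′⊆w , s≤s shorter , ∙-congˡ w′≈w

  reducible-deletion : ∀ s w → Any (λ y → y ≈ gen s) (reflections w) → Reducible (s ∷ w)
  reducible-deletion s w s∈w with reflections-split (λ y → y ≈ gen s) w s∈w
  ... | u , t , v , ≡.refl , utu≈s =
    u ++ v , s ∷ʳ drop-t , s≤s (length-mono-≤ drop-t) , sym (deletion s u t v (sym utu≈s))
    where
    drop-t : (u ++ v) ⊆ (u ++ t ∷ v)
    drop-t = ++⁺ ⊆-refl (t ∷ʳ ⊆-refl)

  Distinct : List Carrier → Set (c ⊔ ℓ)
  Distinct = AllPairs (λ x y → ¬ x ≈ y)

  reducible-or-distinct : ∀ w → Reducible w ⊎ Distinct (reflections w)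
  reducible-or-distinct []      = inj₂ []
  reducible-or-distinct (s ∷ w) with reducible-or-distinct w
  ... | inj₁ reducible = inj₁ (reducible-∷ s reducible)
  ... | inj₂ distinct with Any.any? (λ y → y ≟ gen s) (reflections w)
  ...   | yes s∈w = inj₁ (reducible-deletion s w s∈w)
  ...   | no  s∉w =
    inj₂ (s-fresh ∷ AllPairsProperties.map⁺ (AllPairs.map (λ x≉y → x≉y ∘ conj-injective s) distinct))
    where
    s-fresh : All (λ y → ¬ gen s ≈ y) (map (conj s) (reflections w))
    s-fresh = AllProperties.map⁺ (All.map (λ y≉s s≈sys → y≉s (trans (sym (conj-transpose s s≈sys)) (conj-gen s)))
                                          (AllProperties.¬Any⇒All¬ (reflections w) s∉w))

  module _ (finite : IsFinite W) (cox : IsCoxeterSystem W gen) where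
    open IsCoxeterSystem cox using (nontrivial; injective)

    -- a word avoiding r and crossing distinct reflections does not represent r: it
    -- crosses the reflection s of its first letter once, the word r crosses only r,
    -- so invariance of the cocycle would force s = r
    distinct-not-generator : ∀ r w → All (_≢ r) w → Distinct (reflections w) → ¬ ⟦ w ⟧ ≈ gen r
    distinct-not-generator r []      []          _             []≈r = nontrivial r (sym []≈r)
    distinct-not-generator r (s ∷ w) (s≢r ∷ _) (s-fresh ∷ _) w≈r = s≢r (injective s r (≟ᵇ-sound s-crosses-r))
      where
      s-crosses-w : parity (s ∷ w) (gen s) ≡ true
      s-crosses-w = ≡.cong₂ _xor_ (dec-true (gen s ≟ gen s) refl) (occurs-absent s-fresh)
      s-crosses-r : (gen s ≟ᵇ gen r) ≡ true
      s-crosses-r = ≡.trans (≡.sym (xor-identityʳ _))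
        (≡.trans (parity-invariant finite cox {r ∷ []} {s ∷ w} (trans (identityʳ (gen r)) (sym w≈r)) (gen s))
                 s-crosses-w)

    -- no generator r lies in W_{S∖{r}}: by induction on a bound for the length of
    -- the word, replacing reducible words by shorter subwords
    generator-not-in-parabolic-bounded : ∀ bound r w → length w ≤ bound → All (_≢ r) w → ¬ ⟦ w ⟧ ≈ gen r
    generator-not-in-parabolic-bounded bound r w bounded avoids w≈r with reducible-or-distinct w
    ... | inj₂ distinct = distinct-not-generator r w avoids distinct w≈r
    generator-not-in-parabolic-bounded (suc bound) r w bounded avoids w≈r | inj₁ (w′ , w′⊆w , shorter , w′≈w) =
      generator-not-in-parabolic-bounded bound r w′ (≤-pred (≤-trans shorter bounded))
                                         (All-resp-⊆ w′⊆w avoids) (trans w′≈w w≈r)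
    generator-not-in-parabolic-bounded zero    r w bounded avoids w≈r | inj₁ (w′ , w′⊆w , shorter , w′≈w)
      with ≤-trans shorter bounded
    ... | ()

¬¬-∀-Fin : ∀ {a} k {P : Fin k → Set a} → (∀ i → ¬ ¬ P i) → ¬ ¬ (∀ i → P i)
¬¬-∀-Fin zero    ¬¬P ¬∀P = ¬∀P (λ ())
¬¬-∀-Fin (suc k) ¬¬P ¬∀P =
  ¬¬P zero (λ P₀ → ¬¬-∀-Fin k (¬¬P ∘ suc) (λ P₊ → ¬∀P (λ { zero → P₀ ; (suc i) → P₊ i })))

finite-¬¬-decidable : ∀ {c ℓ} (W : Group c ℓ) → IsFinite W → ¬ ¬ (∀ x y → Dec (Group._≈_ W x y))
finite-¬¬-decidable W (k , element , index) =
  ¬¬-map decide (¬¬-∀-Fin k (λ i → ¬¬-∀-Fin k (λ j → ¬¬-excluded-middle)))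
  where
  open Group W
  decide : (∀ i j → Dec (element i ≈ element j)) → ∀ x y → Dec (x ≈ y)
  decide _≟ₑ_ x y with index x | index y
  ... | i , x≈xᵢ | j , y≈xⱼ with i ≟ₑ j
  ...   | yes xᵢ≈xⱼ = yes (trans x≈xᵢ (trans xᵢ≈xⱼ (sym y≈xⱼ)))
  ...   | no  xᵢ≉xⱼ = no (λ x≈y → xᵢ≉xⱼ (trans (sym x≈xᵢ) (trans x≈y y≈xⱼ)))

-- In a finite Coxeter system no generator r lies in the parabolic subgroup W_{S∖{r}}.
-- The claim is negative, so decidability of equality may be assumed.
generator-not-in-parabolic : ∀ {c ℓ n} (W : Group c ℓ) (gen : Fin n → Group.Carrier W) →
                             IsFinite W → IsCoxeterSystem W gen →
                             ∀ r w → All (_≢ r) w → ¬ Group._≈_ W (eval W gen w) (gen r)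
generator-not-in-parabolic W gen finite cox r w avoids w≈r =
  finite-¬¬-decidable W finite (λ _≟_ →
    ReflectionCocycle.generator-not-in-parabolic-bounded W gen (IsCoxeterSystem.involution cox) _≟_ finite cox
      (length w) r w (≤-reflexive ≡.refl) avoids w≈r)

otherSides : ∀ {k} → Fin k → List (Fin k)
otherSides {suc k} s = tabulate (punchIn s)

otherSides-length : ∀ {k} (s : Fin k) → length (otherSides s) ≡ k ∸ 1
otherSides-length {suc k} s = length-tabulate (punchIn s)

otherSides-unique : ∀ {k} (s : Fin k) → Unique (otherSides s)
otherSides-unique {suc k} s = UniqueProperties.tabulate⁺ (punchIn-injective s _ _)

otherSides-avoid : ∀ {k} (s : Fin k) → All (_≢ s) (otherSides s)
otherSides-avoid {suc k} s = AllProperties.tabulate⁺ (punchInᵢ≢i s)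

module CoxeterComplex {c ℓ : Level} {n : ℕ} (W : Group c ℓ) (gen : Fin n → Group.Carrier W)
         (finite : IsFinite W) (cox : IsCoxeterSystem W gen) where

  open Group W
  open IsCoxeterSystem cox using (involution)
  open Involutions W gen involution
  open GroupProperties W using (quasigroup)
  open import Algebra.Properties.Quasigroup quasigroup using (cancelˡ)

  parabolic-gen : ∀ {r s} → s ≢ r → InParabolic W gen r (gen s)
  parabolic-gen s≢r = _ ∷ [] , s≢r ∷ [] , sym (identityʳ _)

  parabolic-∙ : ∀ {r x y} → InParabolic W gen r x → InParabolic W gen r y → InParabolic W gen r (x ∙ y)
  parabolic-∙ (u , u-avoids , x≈u) (v , v-avoids , y≈v) =
    u ++ v , AllProperties.++⁺ u-avoids v-avoids , trans (∙-cong x≈u y≈v) (sym (⟦⟧-++ u v))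

  same-vertex-refl : ∀ {a} → SameVertex W gen a a
  same-vertex-refl x = (λ x∈a → x∈a) , (λ x∈a → x∈a)

  same-vertex : ∀ {r u u′ z} → InParabolic W gen r z → z ∙ z ≈ ε → u′ ≈ u ∙ z →
                SameVertex W gen (r , u) (r , u′)
  same-vertex {r} {u} {u′} {z} z∈P zz≈ε u′≈uz x = into , back
    where
    open SetoidReasoning setoid
    into : InVertex W gen (r , u) x → InVertex W gen (r , u′) x
    into (y , y∈P , x≈uy) = z ∙ y , parabolic-∙ z∈P y∈P , (begin
      x                ≈⟨ x≈uy ⟩
      u ∙ y            ≈⟨ ∙-congˡ (trans (∙-congʳ zz≈ε) (identityˡ y)) ⟨
      u ∙ ((z ∙ z) ∙ y) ≈⟨ ∙-congˡ (assoc z z y) ⟩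
      u ∙ (z ∙ (z ∙ y)) ≈⟨ assoc u z (z ∙ y) ⟨
      (u ∙ z) ∙ (z ∙ y) ≈⟨ ∙-congʳ u′≈uz ⟨
      u′ ∙ (z ∙ y)     ∎)
    back : InVertex W gen (r , u′) x → InVertex W gen (r , u) x
    back (y , y∈P , x≈u′y) = z ∙ y , parabolic-∙ z∈P y∈P , trans x≈u′y (trans (∙-congʳ u′≈uz) (assoc u z y))

  distinct-vertices : ∀ u {r r′} → r ≢ r′ → ¬ SameVertex W gen (r , u) (r′ , u)
  distinct-vertices u {r} {r′} r≢r′ same with proj₂ (same (u ∙ gen r)) (gen r , parabolic-gen r≢r′ , refl)
  ... | y , (w , w-avoids , y≈w) , ur≈uy =
    generator-not-in-parabolic W gen finite cox r w w-avoids (sym (trans (cancelˡ u _ _ ur≈uy) y≈w))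

  Adjacent : Carrier → Carrier → Set ℓ
  Adjacent u v = (v ≈ u) ⊎ Σ[ s ∈ Fin n ] v ≈ u ∙ gen s

  near-via : ∀ rs {z u u′ k} → Unique rs → All (λ r → InParabolic W gen r z) rs → z ∙ z ≈ ε →
             u′ ≈ u ∙ z → k ≤ length rs → Near W gen k u u′
  near-via rs {z} {u} unique z∈P zz≈ε u′≈uz k≤ =
    map (_, u) rs
    , ≤-trans k≤ (≤-reflexive (≡.sym (length-map (_, u) rs)))
    , AllPairsProperties.map⁺ (AllPairs.map (distinct-vertices u) unique)
    , AllProperties.map⁺
        (All.map (λ {r} z∈Pᵣ → (r , same-vertex-refl) , (r , same-vertex z∈Pᵣ zz≈ε u′≈uz)) z∈P)

  adjacent⇒near : ∀ {u v} → Adjacent u v → Near W gen (n ∸ 1) u v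
  adjacent⇒near (inj₁ v≈u) =
    near-via (allFin n) (UniqueProperties.allFin⁺ n) (All.universal (λ r → [] , [] , refl) (allFin n))
             (identityˡ ε) (trans v≈u (sym (identityʳ _)))
             (≤-trans (m∸n≤m n 1) (≤-reflexive (≡.sym (length-tabulate (λ i → i)))))
  adjacent⇒near (inj₂ (s , v≈us)) =
    near-via (otherSides s) (otherSides-unique s) (All.map (λ r≢s → parabolic-gen (r≢s ∘ ≡.sym)) (otherSides-avoid s))
             (involution s) v≈us (≤-reflexive (≡.sym (otherSides-length s)))

  -- A gallery is described by a list of steps: cross the wall s (just s) or pause (nothing).
  Step : Set
  Step = Maybe (Fin n)

  move : Carrier → Step → Carrier
  move u (just s) = u ∙ gen s
  move u nothing  = u

  visits : Carrier → List Step → List Carrier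
  visits u []       = []
  visits u (t ∷ ts) = move u t ∷ visits (move u t) ts

  gallery : Carrier → List Step → List Carrier
  gallery u ts = u ∷ visits u ts

  end : Carrier → List Step → Carrier
  end u []       = u
  end u (t ∷ ts) = end (move u t) ts

  prefix : Carrier → List Step → List Carrier
  prefix u []       = []
  prefix u (t ∷ ts) = u ∷ prefix (move u t) ts

  gallery-++ : ∀ u xs ys → gallery u (xs ++ ys) ≡ prefix u xs ++ gallery (end u xs) ys
  gallery-++ u []       ys = ≡.refl
  gallery-++ u (t ∷ xs) ys = ≡.cong (u ∷_) (gallery-++ (move u t) xs ys)

  end-++ : ∀ u xs ys → end u (xs ++ ys) ≡ end (end u xs) ys
  end-++ u []       ys = ≡.refl
  end-++ u (t ∷ xs) ys = end-++ (move u t) xs ys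

  move-cong : ∀ t {u v} → u ≈ v → move u t ≈ move v t
  move-cong (just s) u≈v = ∙-congʳ u≈v
  move-cong nothing  u≈v = u≈v

  end-cong : ∀ ts {u v} → u ≈ v → end u ts ≈ end v ts
  end-cong []       u≈v = u≈v
  end-cong (t ∷ ts) u≈v = end-cong ts (move-cong t u≈v)

  g≡gallery : ∀ u w → chain W gen u w ≡ gallery u (map just w)
  g≡gallery u []      = ≡.refl
  g≡gallery u (s ∷ w) = ≡.cong (u ∷_) (g≡gallery (u ∙ gen s) w)

  end-word : ∀ u w → end u (map just w) ≈ u ∙ ⟦ w ⟧
  end-word u []      = sym (identityʳ u)
  end-word u (s ∷ w) = trans (end-word (u ∙ gen s) w) (assoc _ _ _)

  Closed : List Step → Set ℓ
  Closed ts = end ε ts ≈ ε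

  closed-replace : ∀ xs p q ys → (∀ u → end u p ≈ end u q) → Closed (xs ++ q ++ ys) → Closed (xs ++ p ++ ys)
  closed-replace xs p q ys p≈q closed = begin
    end ε (xs ++ p ++ ys)              ≡⟨ end-++ ε xs (p ++ ys) ⟩
    end (end ε xs) (p ++ ys)           ≡⟨ end-++ (end ε xs) p ys ⟩
    end (end (end ε xs) p) ys          ≈⟨ end-cong ys (p≈q (end ε xs)) ⟩
    end (end (end ε xs) q) ys          ≡⟨ ≡.sym (end-++ (end ε xs) q ys) ⟩
    end (end ε xs) (q ++ ys)           ≡⟨ ≡.sym (end-++ ε xs (q ++ ys)) ⟩
    end ε (xs ++ q ++ ys)              ≈⟨ closed ⟩
    ε                                  ∎
    where open SetoidReasoning setoid

  gallery-loop : ∀ ts → Closed ts → IsLoop W gen (n ∸ 1) (gallery ε ts)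
  gallery-loop ts closed = start ε (visits ε ts) refl , ends ε ts closed , consecutive ε ts
    where
    ends : ∀ u ts → end u ts ≈ ε → EndsAtσ₀ W gen (gallery u ts)
    ends u []       u≈ε = here u u≈ε
    ends u (t ∷ ts) e   = there u (move u t) (visits (move u t) ts) (ends (move u t) ts e)
    step-adjacent : ∀ u t → Adjacent u (move u t)
    step-adjacent u (just s) = inj₂ (s , refl)
    step-adjacent u nothing  = inj₁ refl
    consecutive : ∀ u ts → Consecutive W gen (n ∸ 1) (gallery u ts)
    consecutive u []       = single u
    consecutive u (t ∷ ts) = cons u (move u t) (visits (move u t) ts)
                                  (adjacent⇒near (step-adjacent u t)) (consecutive (move u t) ts)

  _≃_ : List Carrier → List Carrier → Set (c ⊔ ℓ)
  _≃_ = Homotopic W gen (n ∸ 1)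

  ≃-sym : ∀ {γ δ} → γ ≃ δ → δ ≃ γ
  ≃-sym = EqClosure.symmetric (HomStep W gen (n ∸ 1))

  ≃-trans : ∀ {γ δ ζ} → γ ≃ δ → δ ≃ ζ → γ ≃ ζ
  ≃-trans = EqClosure.transitive (HomStep W gen (n ∸ 1))

  -- inserting a pause repeats a chamber: a stretching
  pause : ∀ xs ys → Closed (xs ++ ys) → gallery ε (xs ++ ys) ≃ gallery ε (xs ++ nothing ∷ ys)
  pause xs ys closed = ≡.subst₂ _≃_ (≡.sym (gallery-++ ε xs ys)) (≡.sym (gallery-++ ε xs (nothing ∷ ys)))
    (EqClosure.return (stretch (prefix ε xs) (end ε xs) (visits (end ε xs) ys)
       (≡.subst (IsLoop W gen (n ∸ 1)) (gallery-++ ε xs ys) (gallery-loop (xs ++ ys) closed))))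

  regrid : ∀ ts ts′ → Closed ts → Closed ts′ → Pointwise Adjacent (gallery ε ts) (gallery ε ts′) →
           gallery ε ts ≃ gallery ε ts′
  regrid ts ts′ closed closed′ adjacent =
    EqClosure.return (grid _ _ (gallery-loop ts closed) (gallery-loop ts′ closed′) (Pw.map adjacent⇒near adjacent))

  gallery-equal : ∀ ts {u v} → u ≈ v → Pointwise Adjacent (gallery u ts) (gallery v ts)
  gallery-equal []       u≈v = inj₁ (sym u≈v) ∷ []
  gallery-equal (t ∷ ts) u≈v = inj₁ (sym u≈v) ∷ gallery-equal ts (move-cong t u≈v)

  gallery-prefix : ∀ xs {u p q} → Pointwise Adjacent (gallery (end u xs) p) (gallery (end u xs) q) →
                   Pointwise Adjacent (gallery u (xs ++ p)) (gallery u (xs ++ q))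
  gallery-prefix []       adjacent = adjacent
  gallery-prefix (t ∷ xs) adjacent = inj₁ refl ∷ gallery-prefix xs adjacent

  local-move : ∀ xs p q ys → (∀ u → end u p ≈ end u q) →
               (∀ u → Pointwise Adjacent (gallery u (p ++ ys)) (gallery u (q ++ ys))) →
               Closed (xs ++ q ++ ys) → gallery ε (xs ++ p ++ ys) ≃ gallery ε (xs ++ q ++ ys)
  local-move xs p q ys p≈q adjacent closed =
    regrid _ _ (closed-replace xs p q ys p≈q closed) closed (gallery-prefix xs (adjacent (end ε xs)))

  -- crossing a wall twice is homotopic to not crossing it:
  -- xs ys  ~  xs ∘ ys  ~  xs ∘ ∘ ys  ~  xs s s ys  (two stretchings and a grid)
  cancel-move : ∀ xs s ys → Closed (xs ++ ys) → gallery ε (xs ++ ys) ≃ gallery ε (xs ++ just s ∷ just s ∷ ys)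
  cancel-move xs s ys closed =
    ≃-trans (pause xs ys closed)
      (≃-trans (pause xs (nothing ∷ ys) (closed-replace xs (nothing ∷ []) [] ys (λ u → refl) closed))
        (local-move xs (nothing ∷ nothing ∷ []) (just s ∷ just s ∷ []) ys (λ u → sym (gen-cancelʳ u s)) grid-ss
           (closed-replace xs (just s ∷ just s ∷ []) [] ys (λ u → gen-cancelʳ u s) closed)))
    where
    -- u u u ⋯  against  u us uss ⋯
    grid-ss : ∀ u → Pointwise Adjacent (gallery u (nothing ∷ nothing ∷ ys)) (gallery u (just s ∷ just s ∷ ys))
    grid-ss u = inj₁ refl ∷ inj₂ (s , refl) ∷ gallery-equal ys (sym (gen-cancelʳ u s))

  -- crossing two commuting walls in either order gives homotopic galleries:
  -- xs s t ys  ~  xs ∘ s t ys  ~  xs t s ∘ ys  ~  xs ∘ t s ys  ~  xs t s ys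
  commute-move : ∀ xs s t ys → gen s ∙ gen t ≈ gen t ∙ gen s → Closed (xs ++ just s ∷ just t ∷ ys) →
                 gallery ε (xs ++ just s ∷ just t ∷ ys) ≃ gallery ε (xs ++ just t ∷ just s ∷ ys)
  commute-move xs s t ys st≈ts closed =
    ≃-trans (pause xs (just s ∷ just t ∷ ys) closed)
      (≃-trans (local-move xs (nothing ∷ just s ∷ just t ∷ []) (just t ∷ just s ∷ nothing ∷ []) ys swap
                           grid-∘st (closed-like-ts (just t ∷ just s ∷ nothing ∷ []) (λ u → refl)))
        (≃-trans (local-move xs (just t ∷ just s ∷ nothing ∷ []) (nothing ∷ just t ∷ just s ∷ []) ys (λ u → refl)
                             grid-ts∘ (closed-like-ts (nothing ∷ just t ∷ just s ∷ []) (λ u → refl)))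
          (≃-sym (pause xs (just t ∷ just s ∷ ys) (closed-like-ts (just t ∷ just s ∷ []) (λ u → refl))))))
    where
    swap : ∀ u → (u ∙ gen s) ∙ gen t ≈ (u ∙ gen t) ∙ gen s
    swap u = trans (assoc _ _ _) (trans (∙-congˡ st≈ts) (sym (assoc _ _ _)))
    closed-like-ts : ∀ p → (∀ u → end u p ≈ (u ∙ gen t) ∙ gen s) → Closed (xs ++ p ++ ys)
    closed-like-ts p p≈ts = closed-replace xs p (just s ∷ just t ∷ []) ys (λ u → trans (p≈ts u) (sym (swap u))) closed
    -- u u us ust ⋯  against  u ut uts uts ⋯
    grid-∘st : ∀ u → Pointwise Adjacent (gallery u (nothing ∷ just s ∷ just t ∷ ys))
                                        (gallery u (just t ∷ just s ∷ nothing ∷ ys))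
    grid-∘st u = inj₁ refl ∷ inj₂ (t , refl) ∷ inj₂ (t , sym (swap u)) ∷ gallery-equal ys (swap u)
    -- u ut uts ⋯  against  u u ut ⋯
    grid-ts∘ : ∀ u → Pointwise Adjacent (gallery u (just t ∷ just s ∷ nothing ∷ ys))
                                        (gallery u (nothing ∷ just t ∷ just s ∷ ys))
    grid-ts∘ u = inj₁ refl ∷ inj₂ (t , sym (gen-cancelʳ u t)) ∷ inj₂ (s , sym (gen-cancelʳ (u ∙ gen t) s))
                   ∷ gallery-equal ys refl

  g-++ : ∀ xs ys → g W gen (xs ++ ys) ≡ gallery ε (map just xs ++ map just ys)
  g-++ xs ys = ≡.trans (g≡gallery ε (xs ++ ys)) (≡.cong (gallery ε) (map-++ just xs ys))

  closed-++ : ∀ xs ys → ⟦ xs ++ ys ⟧ ≈ ε → Closed (map just xs ++ map just ys)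
  closed-++ xs ys xsys≈ε = ≡.subst Closed (map-++ just xs ys)
    (trans (end-word ε (xs ++ ys)) (trans (identityˡ _) xsys≈ε))

  W'Step-homotopy : ∀ {w v} → W'Step W gen w v → ⟦ w ⟧ ≈ ε → g W gen w ≃ g W gen v
  W'Step-homotopy step@(cancel xs ys s) w≈ε =
    ≡.subst₂ _≃_ (≡.sym (g-++ xs (s ∷ s ∷ ys))) (≡.sym (g-++ xs ys))
      (≃-sym (cancel-move (map just xs) s (map just ys) (closed-++ xs ys (trans (sym (W'Step-sound step)) w≈ε))))
  W'Step-homotopy (commute xs ys s t m≡2) w≈ε =
    ≡.subst₂ _≃_ (≡.sym (g-++ xs (s ∷ t ∷ ys))) (≡.sym (g-++ xs (t ∷ s ∷ ys)))
      (commute-move (map just xs) s t (map just ys) (order-two-commute s t m≡2) (closed-++ xs (s ∷ t ∷ ys) w≈ε))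

  Related : List (Fin n) → List (Fin n) → Set (c ⊔ ℓ)
  Related w v = ⟦ w ⟧ ≈ ⟦ v ⟧ × (⟦ w ⟧ ≈ ε → g W gen w ≃ g W gen v)

  related-isEquivalence : IsEquivalence Related
  related-isEquivalence = record
    { refl  = refl , λ _ → EqClosure.reflexive (HomStep W gen (n ∸ 1))
    ; sym   = λ (w≈v , w∼v) → sym w≈v , λ v≈ε → ≃-sym (w∼v (trans w≈v v≈ε))
    ; trans = λ (w≈v , w∼v) (v≈u , v∼u) →
                trans w≈v v≈u , λ w≈ε → ≃-trans (w∼v w≈ε) (v∼u (trans (sym w≈v) w≈ε))
    }

  W'-equal⇒related : ∀ {w v} → _≡W'_ W gen w v → Related w v
  W'-equal⇒related = EqClosure.fold related-isEquivalence (λ step → W'Step-sound step , W'Step-homotopy step)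

lemma4p5 : {c ℓ : Level} (n : ℕ) (W : Group c ℓ) (gen : Fin n → Group.Carrier W) →
           IsFinite W → IsCoxeterSystem W gen →
           (w v : List (Fin n)) →
           (_≡W'_ W gen w [] →
              Homotopic W gen (n ∸ 1) (g W gen w) (Group.ε W ∷ [])) ×
           (Group._≈_ W (eval W gen w) (Group.ε W) → _≡W'_ W gen w v →
              Homotopic W gen (n ∸ 1) (g W gen w) (g W gen v))
lemma4p5 n W gen finite cox w v =
  (λ w≡1 → let (w≈1 , homotopy) = W'-equal⇒related w≡1 in homotopy w≈1) ,
  (λ w≈1 w≡v → proj₂ (W'-equal⇒related w≡v) w≈1)
  where open CoxeterComplex W gen finite cox
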